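{- Let $n \ge 1$ and let $U \subseteq \mathbb{Z}_3^n$ be $1$-saturated with the subgraph of $H(n,3)$ induced by $U$ having maximum degree at most $1$. Let $H' = \mathbb{Z}_3 \times H'_{red}$ and $H'' = \mathbb{Z}_3 \times H''_{red}$ be affine subsets of $\mathbb{Z}_3^n$ containing the direction $e_1$, and let $U' = U \cap H'$, $U'' = U \cap H''$. (1) If $U'$ is a canonical set for $H'$, then for every $x \in H'_{red}$ the canonical path $P_x$ starting at $x$ ends at the extra point $x_{U'}$ of $U'$. (2) If $U'$ is a canonical set for $H'$, $U''$ is a canonical set for $H''$, and $H' \cap H'' \neq \emptyset$, then $x_{U'} = x_{U''}$ and $U' \cap U''$ is a canonical set for $H' \cap H''$.
   Context: $H(n,3)$ is the Hamming graph on $\mathbb{Z}_3^n$ (vertices adjacent iff they differ in exactly one coordinate); $e_i$ denotes a standard basis vector. $U$ is $1$-saturated if $U \cap \{x,x+e_1,x+2e_1\} \neq \emptyset$ for all $x \in \mathbb{Z}_3^n$. Write $U = \bigcup_{x \in \mathbb{Z}_3^{n-1}} U_f(x) \times \{x\}$ with $U_f(x) \subseteq \mathbb{Z}_3$. A set is canonical (in $\mathbb{Z}_3^m$) if it has at least $3^{m-1}+1$ points, is disjoint from some maximum size independent set of $H(m,3)$, and induces a subgraph of maximum degree at most $1$. An affine subset is a set $H = \{x : x_i = c_i \ \forall i \in R_H\}$ for some $R_H \subseteq [n]$, $c_i \in \mathbb{Z}_3$; it contains direction $e_i$ if $i \notin R_H$; if it contains $e_1$, $H_{red}$ is defined by $H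 = \mathbb{Z}_3 \times H_{red}$. Identifying an affine subset with $d$ free coordinates with $\mathbb{Z}_3^d$, a subset of it is a canonical set for it if it is canonical under this identification. If $U' = U \cap H'$ is a canonical set for $H'$, its extra point $x_{U'}$ is the unique $x \in H'_{red}$ with $|U_f(x)| = 2$. Canonical path: for $x \in \mathbb{Z}_3^{n-1}$ (with standard basis $e_1,\dots,e_{n-1}$ of $\mathbb{Z}_3^{n-1}$), if there is a direction $i \in [n-1]$ with $U_f(x+e_i) = U_f(x)$, then $P_x$ moves to $y = x + 2e_i$ and continues as $P_y$; if there is $i$ with $U_f(x+2e_i) = U_f(x)$, then $P_x$ moves to $y = x+e_i$ and continues as $P_y$; if there is no direction $i$ with $U_f(x+e_i) = U_f(x)$ or $U_f(x+2e_i) = U_f(x)$, then $P_x$ ends at $x$. -}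

module Defs where

open import Data.Nat using (ℕ; zero; suc; _+_; _^_; _∸_; _≤_)
open import Data.Nat.Properties using (_≟_)
open import Data.Fin using (Fin; zero; suc)
open import Data.Fin.Properties using () renaming (_≟_ to _≟ᶠ_)
open import Data.Bool using (Bool; true; false; T; _∧_; if_then_else_)
open import Data.Maybe using (Maybe; just; nothing)
open import Data.Vec using (Vec; []; _∷_; updateAt)
open import Data.List using (List; []; _∷_; map; concatMap; length; filterᵇ)
open import Data.Product using (Σ; _×_; ∃)
open import Data.Sum using (_⊎_)
open import Data.Unit using (⊤)
open import Relation.Nullary using (¬_; does)
open import Relation.Binary.PropositionalEquality using (_≡_)

inc₃ : Fin 3 → Fin 3
inc₃ zero = suc zero
inc₃ (suc zero) = suc (suc zero)
inc₃ (suc (suc zero)) = zero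

Pt : ℕ → Set
Pt m = Vec (Fin 3) m

_+e_ : ∀ {m} → Pt m → Fin m → Pt m
x +e i = updateAt x i inc₃

_+2e_ : ∀ {m} → Pt m → Fin m → Pt m
x +2e i = (x +e i) +e i

allFin3 : List (Fin 3)
allFin3 = zero ∷ suc zero ∷ suc (suc zero) ∷ []

allPts : (m : ℕ) → List (Pt m)
allPts zero = [] ∷ []
allPts (suc m) = concatMap (λ a → map (a ∷_) (allPts m)) allFin3

∣_∣ : ∀ {m} → (Pt m → Bool) → ℕ
∣ V ∣ = length (filterᵇ V (allPts _))

dist : ∀ {m} → Pt m → Pt m → ℕ
dist [] [] = 0
dist (a ∷ x) (b ∷ y) = (if does (a ≟ᶠ b) then 0 else 1) + dist x y

adjᵇ : ∀ {m} → Pt m → Pt m → Bool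
adjᵇ x y = does (dist x y ≟ 1)

Adjacent : ∀ {m} → Pt m → Pt m → Set
Adjacent x y = dist x y ≡ 1

Independent : ∀ {m} → (Pt m → Bool) → Set
Independent I = ∀ x y → T (I x) → T (I y) → ¬ Adjacent x y

MaxIndependent : ∀ {m} → (Pt m → Bool) → Set
MaxIndependent {m} I = Independent I × (∀ (J : Pt m → Bool) → Independent J → ∣ J ∣ ≤ ∣ I ∣)

degIn : ∀ {m} → (Pt m → Bool) → Pt m → ℕ
degIn V x = ∣ (λ y → V y ∧ adjᵇ x y) ∣

MaxDeg≤1 : ∀ {m} → (Pt m → Bool) → Set
MaxDeg≤1 V = ∀ x → T (V x) → degIn V x ≤ 1

Canonical : ∀ {m} → (Pt m → Bool) → Set
Canonical {m} V =
  (3 ^ (m ∸ 1) + 1 ≤ ∣ V ∣)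
  × (∃ λ (I : Pt m → Bool) → MaxIndependent I × (∀ x → T (I x) → ¬ T (V x)))
  × MaxDeg≤1 V

-- 1-saturation (first coordinate = direction e_1)

OneSaturated : ∀ {n} → (Pt (suc n) → Bool) → Set
OneSaturated U = ∀ x → T (U x) ⊎ T (U (x +e zero)) ⊎ T (U (x +2e zero))

-- Affine subsets: nothing = free coordinate, just c = coordinate fixed to c

Aff : ℕ → Set
Aff n = Vec (Maybe (Fin 3)) n

_∈A_ : ∀ {n} → Pt n → Aff n → Set
[] ∈A [] = ⊤
(a ∷ x) ∈A (nothing ∷ H) = x ∈A H
(a ∷ x) ∈A (just c ∷ H) = (a ≡ c) × (x ∈A H)

dimA : ∀ {n} → Aff n → ℕ
dimA [] = 0
dimA (nothing ∷ H) = suc (dimA H)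
dimA (just _ ∷ H) = dimA H

-- the identification Z_3^(dim H) ≅ H (free coordinates in order)
embed : ∀ {n} (H : Aff n) → Pt (dimA H) → Pt n
embed [] [] = []
embed (nothing ∷ H) (a ∷ y) = a ∷ embed H y
embed (just c ∷ H) y = c ∷ embed H y

-- intersection of two affine subsets (correct whenever they intersect)
meetA : ∀ {n} → Aff n → Aff n → Aff n
meetA [] [] = []
meetA (nothing ∷ H) (nothing ∷ K) = nothing ∷ meetA H K
meetA (nothing ∷ H) (just c ∷ K) = just c ∷ meetA H K
meetA (just c ∷ H) (_ ∷ K) = just c ∷ meetA H K

-- U ∩ H is a canonical set for H
CanonicalFor : ∀ {n} → (Pt n → Bool) → Aff n → Set
CanonicalFor U H = Canonical (λ y → U (embed H y))

Uf : ∀ {k} → (Pt (suc k) → Bool) → Pt k → Fin 3 → Bool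
Uf U x a = U (a ∷ x)

∣Uf∣ : ∀ {k} → (Pt (suc k) → Bool) → Pt k → ℕ
∣Uf∣ U x = length (filterᵇ (Uf U x) allFin3)

SameFib : ∀ {k} → (Pt (suc k) → Bool) → Pt k → Pt k → Set
SameFib U x y = ∀ a → Uf U x a ≡ Uf U y a

Step : ∀ {k} → (Pt (suc k) → Bool) → Pt k → Pt k → Set
Step U x y = ∃ λ i →
  (SameFib U (x +e i) x × y ≡ x +2e i) ⊎ (SameFib U (x +2e i) x × y ≡ x +e i)

Terminal : ∀ {k} → (Pt (suc k) → Bool) → Pt k → Set
Terminal U x = ∀ i → ¬ SameFib U (x +e i) x × ¬ SameFib U (x +2e i) x

-- PathEndsAt U z x : every canonical path P_x (whatever admissible direction
-- is chosen at each step) is finite and ends at z.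
data PathEndsAt {k} (U : Pt (suc k) → Bool) (z : Pt k) : Pt k → Set where
  stop : ∀ {x} → Terminal U x → x ≡ z → PathEndsAt U z x
  go   : ∀ {x} → ¬ Terminal U x → (∀ y → Step U x y → PathEndsAt U z y) → PathEndsAt U z x

{-# OPTIONS --safe #-}
module Submission where

-- A canonical set for ℤ₃ × Hred avoids a maximum independent set, which meets every fibre exactly
-- once and so is the graph of a proper 3-colouring g of Hred; counting then yields a point xe whose
-- fibre has two levels. Every other x ∈ Hred has a neighbour x' in a direction i with xᵢ ≠ xeᵢ and
-- x'ᵢ ≠ xeᵢ whose fibre shares a level with that of x. This is proved by induction on the distance
-- to xe: next to xe every fibre contains g xe, and the inductive step is a case analysis of the
-- 3 × 3 grid spanned by two coordinates in which x differs from xe, on which g is a Latin square.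
-- Maximum degree one makes the fibres of x and x' equal and leaves no other equal fibre next to x,
-- so the canonical path moves to the third point of the line, closer to xe; at xe it stops.
-- Canonical paths have a single end, so canonical sets through a common point share xe, and the
-- restricted colouring together with the double fibre at xe makes U ∩ H' ∩ H'' canonical.

open import Defs
open import Data.Bool using (Bool; true; false; T; _∧_)
open import Data.Bool.Properties using (T?; T-∧) renaming (_≟_ to _≟ᵇ_)
open import Data.Empty using (⊥; ⊥-elim)
open import Data.Fin using (Fin; zero; suc; toℕ)
open import Data.Fin.Patterns using (0F; 1F; 2F)
open import Data.Fin.Properties using (all?; any?) renaming (_≟_ to _≟ᶠ_)
open import Data.List using (List; []; _∷_; _++_; [_]; map; concatMap; length; filterᵇ)
open import Data.List.Properties using (length-++; length-map; filter-++; map-id)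
open import Data.List.Relation.Binary.Sublist.Heterogeneous using (Sublist; []; _∷_) renaming (map to Sublist-map)
open import Data.List.Relation.Binary.Sublist.Heterogeneous.Properties using (++⁺; ++ˡ; ++ʳ; length-mono-≤; ⊆-filter-Sublist) renaming (map⁺ to Sublist-map⁺)
open import Data.List.Membership.Propositional using (_∈_)
open import Data.List.Membership.Propositional.Properties using (∈-filter⁺; ∈-filter⁻; ∈-map⁺; ∈-concatMap⁺)
import Data.List.Relation.Unary.Any as Any
open import Data.List.Relation.Unary.Any using (here; there)
open import Data.List.Relation.Unary.All using (_∷_; [])
open import Data.List.Relation.Unary.AllPairs using (_∷_; [])
open import Data.List.Relation.Unary.Unique.Propositional using (Unique)
import Data.List.Relation.Unary.Unique.Propositional.Properties as Unique
open import Data.Nat using (ℕ; zero; suc; _+_; _*_; _^_; _≤_; _<_; z≤n; s≤s; s≤s⁻¹; _≤?_; _≟_)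
open import Data.Nat.DivMod using (_mod_)
open import Data.Nat.ListAction using (sum)
open import Data.Nat.Properties using (≤-trans; ≤-refl; +-mono-≤; +-mono-<-≤; +-mono-≤-<; ≰⇒>; +-suc; suc-injective; ≤-reflexive; <-irrefl; ≤-<-trans; n<1⇒n≡0; 1+n≰n; +-comm; 0≢1+n)
open import Data.Nat.Tactic.RingSolver using (solve-∀)
open import Data.Product using (∃; ∃₂; _×_; _,_; proj₁; proj₂)
open import Data.Sum using (_⊎_; inj₁; inj₂)
open import Data.Unit using (tt)
open import Data.Maybe using (just; nothing)
open import Data.Vec using ([]; _∷_; lookup; _[_]≔_)
open import Data.Vec.Properties using (updateAt-id-local; ≡-dec; ∷-injectiveˡ; ∷-injectiveʳ; updateAt-cong-local; updateAt-updateAt-local; []≔-lookup; []≔-idempotent; []≔-commutes; lookup∘update; lookup∘update′)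
open import Function using (_∘_; id; Equivalence)
open import Relation.Nullary using (¬_; Dec; yes; no; does)
open import Relation.Nullary.Decidable using (toWitness; _→-dec_; _⊎-dec_; ¬?; dec-true; dec-false)
open import Relation.Binary.PropositionalEquality using (_≡_; _≢_; refl; sym; trans; cong; cong₂; subst; subst₂; ≢-sym; module ≡-Reasoning)

third : Fin 3 → Fin 3 → Fin 3
third 0F 1F = 2F
third 1F 0F = 2F
third 0F _  = 1F
third 1F _  = 0F
third 2F 0F = 1F
third 2F _  = 0F

third-≢ˡ : ∀ a b → third a b ≢ a
third-≢ˡ = toWitness {a? = all? λ a → all? λ b → ¬? (third a b ≟ᶠ a)} tt

third-≢ʳ : ∀ a b → third a b ≢ b
third-≢ʳ = toWitness {a? = all? λ a → all? λ b → ¬? (third a b ≟ᶠ b)} tt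

avoiding⇒≡ : ∀ {a b c d} → a ≢ b → c ≢ a → c ≢ b → d ≢ a → d ≢ b → c ≡ d
avoiding⇒≡ {a} {b} {c} {d} = toWitness {a? = all? λ (a : Fin 3) → all? λ b → all? λ c → all? λ d →
  ¬? (a ≟ᶠ b) →-dec ¬? (c ≟ᶠ a) →-dec ¬? (c ≟ᶠ b) →-dec ¬? (d ≟ᶠ a) →-dec ¬? (d ≟ᶠ b) →-dec (c ≟ᶠ d)} tt a b c d

inc₃-≢ : ∀ a → inc₃ a ≢ a
inc₃-≢ = toWitness {a? = all? λ a → ¬? (inc₃ a ≟ᶠ a)} tt

inc₃²-≢ : ∀ a → inc₃ (inc₃ a) ≢ a
inc₃²-≢ = toWitness {a? = all? λ a → ¬? (inc₃ (inc₃ a) ≟ᶠ a)} tt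

inc₃²-≢-inc₃ : ∀ a → inc₃ (inc₃ a) ≢ inc₃ a
inc₃²-≢-inc₃ = toWitness {a? = all? λ a → ¬? (inc₃ (inc₃ a) ≟ᶠ inc₃ a)} tt

≢⇒inc₃⊎inc₃² : ∀ {a c} → c ≢ a → c ≡ inc₃ a ⊎ c ≡ inc₃ (inc₃ a)
≢⇒inc₃⊎inc₃² {a} {c} = toWitness {a? = all? λ a → all? λ c →
  ¬? (c ≟ᶠ a) →-dec ((c ≟ᶠ inc₃ a) ⊎-dec (c ≟ᶠ inc₃ (inc₃ a)))} tt a c

_⊕_ : Fin 3 → Fin 3 → Fin 3
a ⊕ b = (toℕ a + toℕ b) mod 3

⊕-cancelˡ : ∀ a {b c} → a ⊕ b ≡ a ⊕ c → b ≡ c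
⊕-cancelˡ a {b} {c} = toWitness {a? = all? λ a → all? λ b → all? λ c →
  (a ⊕ b ≟ᶠ a ⊕ c) →-dec (b ≟ᶠ c)} tt a b c

⊕-cancelʳ : ∀ {a b} c → a ⊕ c ≡ b ⊕ c → a ≡ b
⊕-cancelʳ {a} {b} c = toWitness {a? = all? λ a → all? λ b → all? λ c →
  (a ⊕ c ≟ᶠ b ⊕ c) →-dec (a ≟ᶠ b)} tt a b c

-- Points of ℤ₃ᵐ and the Hamming distance

+e≡[]≔ : ∀ {m} (x : Pt m) i → x +e i ≡ x [ i ]≔ inc₃ (lookup x i)
+e≡[]≔ x i = updateAt-cong-local i x refl

+2e≡[]≔ : ∀ {m} (x : Pt m) i → x +2e i ≡ x [ i ]≔ inc₃ (inc₃ (lookup x i))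
+2e≡[]≔ x i = updateAt-updateAt-local i x refl

module _ {m : ℕ} where

  dist-∷-≡ : ∀ a (x y : Pt m) → dist (a ∷ x) (a ∷ y) ≡ dist x y
  dist-∷-≡ a x y rewrite dec-true (a ≟ᶠ a) refl = refl

  dist-∷-≢ : ∀ {a b} (x y : Pt m) → a ≢ b → dist (a ∷ x) (b ∷ y) ≡ suc (dist x y)
  dist-∷-≢ {a} {b} x y a≢b rewrite dec-false (a ≟ᶠ b) a≢b = refl

dist-self : ∀ {m} (x : Pt m) → dist x x ≡ 0
dist-self [] = refl
dist-self (a ∷ x) = trans (dist-∷-≡ a x x) (dist-self x)

dist-sym : ∀ {m} (x y : Pt m) → dist x y ≡ dist y x
dist-sym [] [] = refl
dist-sym (a ∷ x) (b ∷ y) with a ≟ᶠ b | b ≟ᶠ a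
... | yes _ | yes _ = dist-sym x y
... | no _  | no _  = cong suc (dist-sym x y)
... | yes a≡b | no b≢a = ⊥-elim (b≢a (sym a≡b))
... | no a≢b  | yes b≡a = ⊥-elim (a≢b (sym b≡a))

dist≡0⇒≡ : ∀ {m} {x y : Pt m} → dist x y ≡ 0 → x ≡ y
dist≡0⇒≡ {x = []} {[]} _ = refl
dist≡0⇒≡ {x = a ∷ x} {b ∷ y} d with a ≟ᶠ b
... | yes refl = cong (a ∷_) (dist≡0⇒≡ d)

adjacent-sym : ∀ {m} {x y : Pt m} → Adjacent x y → Adjacent y x
adjacent-sym {x = x} {y} adj = trans (dist-sym y x) adj

adjacent-∷ : ∀ {m} a {x y : Pt m} → Adjacent x y → Adjacent (a ∷ x) (a ∷ y)
adjacent-∷ a {x} {y} adj = trans (dist-∷-≡ a x y) adj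

adjacent-[]≔ : ∀ {m} (x : Pt m) i {c d} → c ≢ d → Adjacent (x [ i ]≔ c) (x [ i ]≔ d)
adjacent-[]≔ (a ∷ x) zero c≢d = trans (dist-∷-≢ x x c≢d) (cong suc (dist-self x))
adjacent-[]≔ (a ∷ x) (suc i) c≢d = adjacent-∷ a {x [ i ]≔ _} {x [ i ]≔ _} (adjacent-[]≔ x i c≢d)

adjacent-to-[]≔ : ∀ {m} (x : Pt m) i {c} → c ≢ lookup x i → Adjacent x (x [ i ]≔ c)
adjacent-to-[]≔ x i {c} c≢xᵢ =
  subst (λ y → Adjacent y (x [ i ]≔ c)) ([]≔-lookup x i) (adjacent-[]≔ x i (≢-sym c≢xᵢ))

dist-step-toward : ∀ {m} (x y : Pt m) i → lookup x i ≢ lookup y i →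
  dist x y ≡ suc (dist (x [ i ]≔ lookup y i) y)
dist-step-toward (a ∷ x) (b ∷ y) zero a≢b = trans (dist-∷-≢ x y a≢b) (cong suc (sym (dist-∷-≡ b x y)))
dist-step-toward (a ∷ x) (b ∷ y) (suc i) xᵢ≢yᵢ =
  trans (cong (_ +_) (dist-step-toward x y i xᵢ≢yᵢ)) (+-suc _ _)

differing-coordinate : ∀ {m} {x y : Pt m} → x ≢ y → ∃ λ i → lookup x i ≢ lookup y i
differing-coordinate {x = []} {[]} x≢y = ⊥-elim (x≢y refl)
differing-coordinate {x = a ∷ x} {b ∷ y} x≢y with a ≟ᶠ b
... | no a≢b = zero , a≢b
... | yes refl with differing-coordinate (x≢y ∘ cong (a ∷_))
...   | i , xᵢ≢yᵢ = suc i , xᵢ≢yᵢ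

dist-suc⇒step-toward : ∀ {m n} (x y : Pt m) → dist x y ≡ suc n →
  ∃ λ i → lookup x i ≢ lookup y i × dist (x [ i ]≔ lookup y i) y ≡ n
dist-suc⇒step-toward x y d with differing-coordinate (λ x≡y → 0≢1+n (trans (sym (dist-self x)) (trans (cong (dist x) x≡y) d)))
... | i , xᵢ≢yᵢ = i , xᵢ≢yᵢ , suc-injective (trans (sym (dist-step-toward x y i xᵢ≢yᵢ)) d)

[]≔-injective : ∀ {m} (x : Pt m) {i j c d} → c ≢ lookup x i →
  x [ i ]≔ c ≡ x [ j ]≔ d → i ≡ j × c ≡ d
[]≔-injective x {i} {j} {c} {d} c≢xᵢ eq with i ≟ᶠ j
... | yes refl = refl , trans (sym (lookup∘update i x c)) (trans (cong (λ y → lookup y i) eq) (lookup∘update i x d))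
... | no i≢j = ⊥-elim (c≢xᵢ (trans (sym (lookup∘update i x c))
                              (trans (cong (λ y → lookup y i) eq) (lookup∘update′ i≢j x d))))

adjacent-∷⁻ : ∀ {m a b} {y z : Pt m} → Adjacent (a ∷ y) (b ∷ z) → (a ≡ b × Adjacent y z) ⊎ (a ≢ b × y ≡ z)
adjacent-∷⁻ {a = a} {b} adj with a ≟ᶠ b
... | yes a≡b = inj₁ (a≡b , adj)
... | no a≢b = inj₂ (a≢b , dist≡0⇒≡ (suc-injective adj))

T-adjᵇ : ∀ {m} {x y : Pt m} → Adjacent x y → T (adjᵇ x y)
T-adjᵇ {x = x} {y} adj = subst T (sym (dec-true (dist x y ≟ 1) adj)) tt

-- Counting

module _ {A : Set} where

  length-filterᵇ-++ : ∀ (P : A → Bool) xs ys →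
    length (filterᵇ P (xs ++ ys)) ≡ length (filterᵇ P xs) + length (filterᵇ P ys)
  length-filterᵇ-++ P xs ys = trans (cong length (filter-++ (T? ∘ P) xs ys)) (length-++ (filterᵇ P xs))

  ∈⇒1≤length : ∀ {x : A} {xs} → x ∈ xs → 1 ≤ length xs
  ∈⇒1≤length {xs = _ ∷ _} _ = s≤s z≤n

  1≤length⇒∈ : ∀ {xs : List A} → 1 ≤ length xs → ∃ (_∈ xs)
  1≤length⇒∈ {x ∷ _} _ = x , here refl

  distinct⇒2≤length : ∀ {x y : A} {xs} → x ∈ xs → y ∈ xs → x ≢ y → 2 ≤ length xs
  distinct⇒2≤length {xs = _ ∷ _ ∷ _} _ _ _ = s≤s (s≤s z≤n)
  distinct⇒2≤length (here refl) (here refl) x≢y = ⊥-elim (x≢y refl)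

  2≤length⇒distinct : ∀ {xs : List A} → Unique xs → 2 ≤ length xs →
    ∃₂ λ x y → x ∈ xs × y ∈ xs × x ≢ y
  2≤length⇒distinct {x ∷ []} _ (s≤s ())
  2≤length⇒distinct {x ∷ y ∷ _} ((x≢y ∷ _) ∷ _) _ = x , y , here refl , there (here refl) , x≢y

  module _ (f : A → ℕ) where

    sum≤length : (∀ x → f x ≤ 1) → ∀ xs → sum (map f xs) ≤ length xs
    sum≤length f≤1 [] = z≤n
    sum≤length f≤1 (x ∷ xs) = +-mono-≤ (f≤1 x) (sum≤length f≤1 xs)

    sum<length : (∀ x → f x ≤ 1) → ∀ {y xs} → y ∈ xs → f y ≡ 0 → sum (map f xs) < length xs
    sum<length f≤1 {xs = x ∷ xs} (here refl) fy≡0 rewrite fy≡0 = s≤s (sum≤length f≤1 xs)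
    sum<length f≤1 {xs = x ∷ xs} (there y∈xs) fy≡0 =
      +-mono-≤-< (f≤1 x) (sum<length f≤1 y∈xs fy≡0)

    length≤sum : (∀ x → 1 ≤ f x) → ∀ xs → length xs ≤ sum (map f xs)
    length≤sum 1≤f [] = z≤n
    length≤sum 1≤f (x ∷ xs) = +-mono-≤ (1≤f x) (length≤sum 1≤f xs)

    length<sum : (∀ x → 1 ≤ f x) → ∀ {y xs} → y ∈ xs → 2 ≤ f y → length xs < sum (map f xs)
    length<sum 1≤f {xs = x ∷ xs} (here refl) 2≤fy = +-mono-<-≤ 2≤fy (length≤sum 1≤f xs)
    length<sum 1≤f {xs = x ∷ xs} (there y∈xs) 2≤fy =
      +-mono-≤-< (1≤f x) (length<sum 1≤f y∈xs 2≤fy)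

    pigeonhole : ∀ xs → length xs < sum (map f xs) → ∃ λ y → y ∈ xs × 2 ≤ f y
    pigeonhole (x ∷ xs) len<sum with 2 ≤? f x
    ... | yes 2≤fx = x , here refl , 2≤fx
    ... | no 2≰fx with pigeonhole xs (s≤s⁻¹ (≤-trans len<sum (+-mono-≤ (s≤s⁻¹ (≰⇒> 2≰fx)) ≤-refl)))
    ...   | y , y∈xs , 2≤fy = y , there y∈xs , 2≤fy

length-filterᵇ-map : ∀ {A B : Set} (P : B → Bool) (f : A → B) xs →
  length (filterᵇ P (map f xs)) ≡ length (filterᵇ (P ∘ f) xs)
length-filterᵇ-map P f [] = refl
length-filterᵇ-map P f (x ∷ xs) with P (f x)
... | true = cong suc (length-filterᵇ-map P f xs)
... | false = length-filterᵇ-map P f xs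

∈-allFin3 : ∀ a → a ∈ allFin3
∈-allFin3 0F = here refl
∈-allFin3 1F = there (here refl)
∈-allFin3 2F = there (there (here refl))

unique-allFin3 : Unique allFin3
unique-allFin3 = ((λ ()) ∷ (λ ()) ∷ []) ∷ ((λ ()) ∷ []) ∷ [] ∷ []

∈-allPts : ∀ {m} (x : Pt m) → x ∈ allPts m
∈-allPts [] = here refl
∈-allPts {suc m} (a ∷ x) = ∈-concatMap⁺ (λ b → map (b ∷_) (allPts m)) (Any.map (λ { refl → ∈-map⁺ (a ∷_) (∈-allPts x) }) (∈-allFin3 a))

length-allPts : ∀ m → length (allPts m) ≡ 3 ^ m
length-allPts zero = refl
length-allPts (suc m) = trans (length-slices allFin3) (cong (3 *_) (length-allPts m))
  where
  length-slices : ∀ as → length (concatMap (λ a → map (a ∷_) (allPts m)) as) ≡ length as * length (allPts m)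
  length-slices [] = refl
  length-slices (a ∷ as) =
    trans (length-++ (map (a ∷_) (allPts m))) (cong₂ _+_ (length-map (a ∷_) (allPts m)) (length-slices as))

∣∣≡sum-∣Uf∣ : ∀ {m} (V : Pt (suc m) → Bool) → ∣ V ∣ ≡ sum (map (∣Uf∣ V) (allPts m))
∣∣≡sum-∣Uf∣ {m} V = count-slices (allPts m)
  where
  open ≡-Reasoning
  count : List (Pt (suc m)) → ℕ
  count xs = length (filterᵇ V xs)
  count₃ : ∀ xs ys zs → count (xs ++ (ys ++ (zs ++ []))) ≡ count xs + (count ys + (count zs + 0))
  count₃ xs ys zs = trans (length-filterᵇ-++ V xs _) (cong (count xs +_)
    (trans (length-filterᵇ-++ V ys _) (cong (count ys +_) (length-filterᵇ-++ V zs []))))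
  interchange : ∀ a b c p q r → (a + p) + ((b + q) + ((c + r) + 0)) ≡ (a + (b + (c + 0))) + (p + (q + (r + 0)))
  interchange = solve-∀
  count-slices : ∀ ys → count (concatMap (λ a → map (a ∷_) ys) allFin3) ≡ sum (map (∣Uf∣ V) ys)
  count-slices [] = refl
  count-slices (y ∷ ys) = begin
    count (((0F ∷ y) ∷ slice 0F) ++ (((1F ∷ y) ∷ slice 1F) ++ (((2F ∷ y) ∷ slice 2F) ++ [])))
      ≡⟨ count₃ ((0F ∷ y) ∷ slice 0F) ((1F ∷ y) ∷ slice 1F) ((2F ∷ y) ∷ slice 2F) ⟩
    count ([ 0F ∷ y ] ++ slice 0F) + (count ([ 1F ∷ y ] ++ slice 1F) + (count ([ 2F ∷ y ] ++ slice 2F) + 0))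
      ≡⟨ cong₂ _+_ (split 0F) (cong₂ _+_ (split 1F) (cong (_+ 0) (split 2F))) ⟩
    (point 0F + count (slice 0F)) + ((point 1F + count (slice 1F)) + ((point 2F + count (slice 2F)) + 0))
      ≡⟨ interchange (point 0F) (point 1F) (point 2F) (count (slice 0F)) (count (slice 1F)) (count (slice 2F)) ⟩
    (point 0F + (point 1F + (point 2F + 0))) + (count (slice 0F) + (count (slice 1F) + (count (slice 2F) + 0)))
      ≡⟨ cong₂ _+_ (sym fibre) (sym (count₃ (slice 0F) (slice 1F) (slice 2F))) ⟩
    ∣Uf∣ V y + count (concatMap (λ a → map (a ∷_) ys) allFin3)
      ≡⟨ cong (∣Uf∣ V y +_) (count-slices ys) ⟩
    ∣Uf∣ V y + sum (map (∣Uf∣ V) ys) ∎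
    where
    slice : Fin 3 → List (Pt (suc m))
    slice a = map (a ∷_) ys
    point : Fin 3 → ℕ
    point a = count [ a ∷ y ]
    split : ∀ a → count ([ a ∷ y ] ++ slice a) ≡ point a + count (slice a)
    split a = length-filterᵇ-++ V [ a ∷ y ] (slice a)
    fibre : ∣Uf∣ V y ≡ point 0F + (point 1F + (point 2F + 0))
    fibre = trans (sym (length-filterᵇ-map V (_∷ y) allFin3)) (count₃ [ 0F ∷ y ] [ 1F ∷ y ] [ 2F ∷ y ])

DoubleFibre : ∀ {m} → (Pt (suc m) → Bool) → Pt m → Set
DoubleFibre V y = ∃₂ λ a b → a ≢ b × T (V (a ∷ y)) × T (V (b ∷ y))

module _ {m} (V : Pt (suc m) → Bool) (y : Pt m) where

  private
    levels : List (Fin 3)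
    levels = filterᵇ (Uf V y) allFin3

    ∈-levels : ∀ {a} → T (V (a ∷ y)) → a ∈ levels
    ∈-levels {a} = ∈-filter⁺ (T? ∘ Uf V y) (∈-allFin3 a)

    levels-∈ : ∀ {a} → a ∈ levels → T (V (a ∷ y))
    levels-∈ = proj₂ ∘ ∈-filter⁻ (T? ∘ Uf V y)

  level⇒1≤∣Uf∣ : ∀ {a} → T (V (a ∷ y)) → 1 ≤ ∣Uf∣ V y
  level⇒1≤∣Uf∣ = ∈⇒1≤length ∘ ∈-levels

  1≤∣Uf∣⇒level : 1 ≤ ∣Uf∣ V y → ∃ λ a → T (V (a ∷ y))
  1≤∣Uf∣⇒level 1≤∣Uf∣ with 1≤length⇒∈ 1≤∣Uf∣
  ... | a , a∈levels = a , levels-∈ a∈levels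

  DoubleFibre⇒2≤∣Uf∣ : DoubleFibre V y → 2 ≤ ∣Uf∣ V y
  DoubleFibre⇒2≤∣Uf∣ (a , b , a≢b , Va , Vb) = distinct⇒2≤length (∈-levels Va) (∈-levels Vb) a≢b

  2≤∣Uf∣⇒DoubleFibre : 2 ≤ ∣Uf∣ V y → DoubleFibre V y
  2≤∣Uf∣⇒DoubleFibre 2≤∣Uf∣ with 2≤length⇒distinct (Unique.filter⁺ (T? ∘ Uf V y) unique-allFin3) 2≤∣Uf∣
  ... | a , b , a∈ , b∈ , a≢b = a , b , a≢b , levels-∈ a∈ , levels-∈ b∈

OneSaturated⇒level : ∀ {k} {U : Pt (suc k) → Bool} → OneSaturated U → ∀ x → ∃ λ a → T (U (a ∷ x))
OneSaturated⇒level sat x with sat (0F ∷ x)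
... | inj₁ U0x = 0F , U0x
... | inj₂ (inj₁ U1x) = 1F , U1x
... | inj₂ (inj₂ U2x) = 2F , U2x

-- Affine subsets

∈A-[]≔ : ∀ {m} (H : Aff m) x i c → x ∈A H → lookup H i ≡ nothing → (x [ i ]≔ c) ∈A H
∈A-[]≔ (nothing ∷ H) (a ∷ x) zero c x∈H _ = x∈H
∈A-[]≔ (just _ ∷ H) (a ∷ x) zero c _ ()
∈A-[]≔ (nothing ∷ H) (a ∷ x) (suc i) c x∈H free = ∈A-[]≔ H x i c x∈H free
∈A-[]≔ (just _ ∷ H) (a ∷ x) (suc i) c (a≡ , x∈H) free = a≡ , ∈A-[]≔ H x i c x∈H free

differ⇒free : ∀ {m} (H : Aff m) x y i → x ∈A H → y ∈A H → lookup x i ≢ lookup y i → lookup H i ≡ nothing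
differ⇒free (nothing ∷ H) (_ ∷ _) (_ ∷ _) zero _ _ _ = refl
differ⇒free (just c ∷ H) (_ ∷ _) (_ ∷ _) zero (refl , _) (refl , _) a≢b = ⊥-elim (a≢b refl)
differ⇒free (nothing ∷ H) (_ ∷ x) (_ ∷ y) (suc i) = differ⇒free H x y i
differ⇒free (just c ∷ H) (_ ∷ x) (_ ∷ y) (suc i) (_ , x∈H) (_ , y∈H) = differ⇒free H x y i x∈H y∈H

∈A-meetA : ∀ {m} {H K : Aff m} {x} → x ∈A H → x ∈A K → x ∈A meetA H K
∈A-meetA {H = []} {[]} {[]} _ _ = tt
∈A-meetA {H = nothing ∷ H} {nothing ∷ K} {a ∷ x} x∈H x∈K = ∈A-meetA {H = H} {K} {x} x∈H x∈K
∈A-meetA {H = nothing ∷ H} {just c ∷ K} {a ∷ x} x∈H (a≡c , x∈K) = a≡c , ∈A-meetA {H = H} {K} {x} x∈H x∈K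
∈A-meetA {H = just c ∷ H} {nothing ∷ K} {a ∷ x} (a≡c , x∈H) x∈K = a≡c , ∈A-meetA {H = H} {K} {x} x∈H x∈K
∈A-meetA {H = just c ∷ H} {just _ ∷ K} {a ∷ x} (a≡c , x∈H) (_ , x∈K) = a≡c , ∈A-meetA {H = H} {K} {x} x∈H x∈K

∈A-meetA⇒∈A : ∀ {m} {H K : Aff m} {x} → x ∈A meetA H K → x ∈A H
∈A-meetA⇒∈A {H = []} {[]} {[]} _ = tt
∈A-meetA⇒∈A {H = nothing ∷ H} {nothing ∷ K} {a ∷ x} x∈M = ∈A-meetA⇒∈A {H = H} {K} {x} x∈M
∈A-meetA⇒∈A {H = nothing ∷ H} {just c ∷ K} {a ∷ x} (_ , x∈M) = ∈A-meetA⇒∈A {H = H} {K} {x} x∈M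
∈A-meetA⇒∈A {H = just c ∷ H} {_ ∷ K} {a ∷ x} (a≡c , x∈M) = a≡c , ∈A-meetA⇒∈A {H = H} {K} {x} x∈M

proj : ∀ {n} (H : Aff n) → Pt n → Pt (dimA H)
proj [] [] = []
proj (nothing ∷ H) (a ∷ x) = a ∷ proj H x
proj (just _ ∷ H) (_ ∷ x) = proj H x

embed-∈A : ∀ {n} (H : Aff n) y → embed H y ∈A H
embed-∈A [] [] = tt
embed-∈A (nothing ∷ H) (a ∷ y) = embed-∈A H y
embed-∈A (just c ∷ H) y = refl , embed-∈A H y

embed-proj : ∀ {n} (H : Aff n) {x} → x ∈A H → embed H (proj H x) ≡ x
embed-proj [] {[]} _ = refl
embed-proj (nothing ∷ H) {a ∷ x} x∈H = cong (a ∷_) (embed-proj H x∈H)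
embed-proj (just c ∷ H) {a ∷ x} (a≡c , x∈H) = cong₂ _∷_ (sym a≡c) (embed-proj H x∈H)

dist-embed : ∀ {n} (H : Aff n) y z → dist (embed H y) (embed H z) ≡ dist y z
dist-embed [] [] [] = refl
dist-embed (nothing ∷ H) (a ∷ y) (b ∷ z) = cong (_ +_) (dist-embed H y z)
dist-embed (just c ∷ H) y z = trans (dist-∷-≡ c (embed H y) (embed H z)) (dist-embed H y z)

dist-proj : ∀ {n} (H : Aff n) {x y} → x ∈A H → y ∈A H → dist (proj H x) (proj H y) ≡ dist x y
dist-proj H {x} {y} x∈H y∈H =
  trans (sym (dist-embed H (proj H x) (proj H y))) (cong₂ dist (embed-proj H x∈H) (embed-proj H y∈H))

embed-sublist : ∀ {n} (H : Aff n) → Sublist (λ y x → embed H y ≡ x) (allPts (dimA H)) (allPts n)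
embed-sublist [] = refl ∷ []
embed-sublist (nothing ∷ H) = ++⁺ (slice 0F) (++⁺ (slice 1F) (++⁺ (slice 2F) []))
  where
  slice : ∀ a → Sublist (λ y x → embed (nothing ∷ H) y ≡ x) (map (a ∷_) (allPts (dimA H))) (map (a ∷_) (allPts _))
  slice a = Sublist-map⁺ (a ∷_) (a ∷_) (Sublist-map (cong (a ∷_)) (embed-sublist H))
embed-sublist {suc n} (just c ∷ H) = into-slice c (subst (λ ys → Sublist (λ y x → c ∷ embed H y ≡ x) ys (slice c)) (map-id (allPts (dimA H)))
  (Sublist-map⁺ id (c ∷_) (Sublist-map (cong (c ∷_)) (embed-sublist H))))
  where
  slice : Fin 3 → List (Pt (suc n))
  slice a = map (a ∷_) (allPts n)
  into-slice : ∀ {R : Pt (dimA H) → Pt (suc n) → Set} {ys} a → Sublist R ys (slice a) → Sublist R ys (allPts (suc n))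
  into-slice 0F s = ++ʳ (slice 1F ++ (slice 2F ++ [])) s
  into-slice 1F s = ++ˡ (slice 0F) (++ʳ (slice 2F ++ []) s)
  into-slice 2F s = ++ˡ (slice 0F) (++ˡ (slice 1F) (++ʳ [] s))

∣∣-mono-embed : ∀ {n} (H : Aff n) {P : Pt (dimA H) → Bool} {Q : Pt n → Bool} →
  (∀ y → T (P y) → T (Q (embed H y))) → ∣ P ∣ ≤ ∣ Q ∣
∣∣-mono-embed H {P} {Q} P⇒Q =
  length-mono-≤ (⊆-filter-Sublist (T? ∘ P) (T? ∘ Q) (λ { {y} refl → P⇒Q y }) (embed-sublist H))

-- Independent sets, degrees and canonical sets

Proper : ∀ {m} → (Pt m → Fin 3) → Set
Proper c = ∀ y z → Adjacent y z → c y ≢ c z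

graph : ∀ {m} → (Pt m → Fin 3) → Pt (suc m) → Bool
graph c (a ∷ y) = does (a ≟ᶠ c y)

graph-independent : ∀ {m} {c : Pt m → Fin 3} → Proper c → Independent (graph c)
graph-independent {c = c} proper (a ∷ y) (b ∷ z) Ta Tb adj
  with a ≟ᶠ c y | b ≟ᶠ c z | adjacent-∷⁻ {a = a} {b} {y} {z} adj
... | yes refl | yes refl | inj₁ (cy≡cz , y~z) = proper y z y~z cy≡cz
... | yes refl | yes refl | inj₂ (cy≢cz , refl) = cy≢cz refl
... | no _ | _ | _ = ⊥-elim Ta
... | yes _ | no _ | _ = ⊥-elim Tb

∣Uf∣-graph : ∀ {m} (c : Pt m → Fin 3) y → ∣Uf∣ (graph c) y ≡ 1
∣Uf∣-graph c y with c y
... | 0F = refl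
... | 1F = refl
... | 2F = refl

3^m≤∣graph∣ : ∀ {m} (c : Pt m → Fin 3) → 3 ^ m ≤ ∣ graph c ∣
3^m≤∣graph∣ {m} c = subst₂ _≤_ (length-allPts m) (sym (∣∣≡sum-∣Uf∣ (graph c)))
  (length≤sum (∣Uf∣ (graph c)) (λ y → ≤-reflexive (sym (∣Uf∣-graph c y))) (allPts m))

independent⇒∣Uf∣≤1 : ∀ {m} {J : Pt (suc m) → Bool} → Independent J → ∀ y → ∣Uf∣ J y ≤ 1
independent⇒∣Uf∣≤1 {J = J} indep y with ∣Uf∣ J y ≤? 1
... | yes ≤1 = ≤1
... | no ≰1 with 2≤∣Uf∣⇒DoubleFibre J y (≰⇒> ≰1)
...   | a , b , a≢b , Ja , Jb = ⊥-elim (indep (a ∷ y) (b ∷ y) Ja Jb (adjacent-[]≔ (a ∷ y) zero a≢b))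

independent⇒∣∣≤3^m : ∀ {m} {J : Pt (suc m) → Bool} → Independent J → ∣ J ∣ ≤ 3 ^ m
independent⇒∣∣≤3^m {m} {J} indep = subst₂ _≤_ (sym (∣∣≡sum-∣Uf∣ J)) (length-allPts m)
  (sum≤length (∣Uf∣ J) (independent⇒∣Uf∣≤1 indep) (allPts m))

graph-maxIndependent : ∀ {m} {c : Pt m → Fin 3} → Proper c → MaxIndependent (graph c)
graph-maxIndependent {c = c} proper =
  graph-independent proper , λ J indep → ≤-trans (independent⇒∣∣≤3^m indep) (3^m≤∣graph∣ c)

sumColour : ∀ {m} → Pt m → Fin 3
sumColour [] = 0F
sumColour (a ∷ y) = a ⊕ sumColour y

sumColour-proper : ∀ {m} → Proper (sumColour {m})
sumColour-proper [] [] ()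
sumColour-proper (a ∷ y) (b ∷ z) adj with adjacent-∷⁻ {a = a} {b} {y} {z} adj
... | inj₁ (refl , y~z) = sumColour-proper y z y~z ∘ ⊕-cancelˡ a
... | inj₂ (a≢b , refl) = a≢b ∘ ⊕-cancelʳ (sumColour y)

maxIndependent⇒level : ∀ {m} {I : Pt (suc m) → Bool} → MaxIndependent I → ∀ y → ∃ λ a → T (I (a ∷ y))
maxIndependent⇒level {m} {I} (indep , max) y with 1 ≤? ∣Uf∣ I y
... | yes 1≤∣Uf∣ = 1≤∣Uf∣⇒level I y 1≤∣Uf∣
... | no 1≰∣Uf∣ = ⊥-elim (<-irrefl refl (≤-<-trans 3^m≤∣I∣ ∣I∣<3^m))
  where
  3^m≤∣I∣ : 3 ^ m ≤ ∣ I ∣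
  3^m≤∣I∣ = ≤-trans (3^m≤∣graph∣ (sumColour {m})) (max (graph sumColour) (graph-independent sumColour-proper))
  ∣I∣<3^m : ∣ I ∣ < 3 ^ m
  ∣I∣<3^m = subst₂ _<_ (sym (∣∣≡sum-∣Uf∣ I)) (length-allPts m)
    (sum<length (∣Uf∣ I) (independent⇒∣Uf∣≤1 indep) {y} (∈-allPts y) (n<1⇒n≡0 (≰⇒> 1≰∣Uf∣)))

T-injective : ∀ {a b} → (T a → T b) → (T b → T a) → a ≡ b
T-injective {false} {false} _ _ = refl
T-injective {false} {true} _ b⇒a = ⊥-elim (b⇒a tt)
T-injective {true} {false} a⇒b _ = ⊥-elim (a⇒b tt)
T-injective {true} {true} _ _ = refl

MaxDeg≤1⇒unique-neighbour : ∀ {m} {V : Pt m → Bool} → MaxDeg≤1 V → ∀ {x y z} →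
  T (V x) → T (V y) → T (V z) → Adjacent x y → Adjacent x z → y ≡ z
MaxDeg≤1⇒unique-neighbour {V = V} maxDeg {x} {y} {z} Vx Vy Vz x~y x~z with ≡-dec _≟ᶠ_ y z
... | yes y≡z = y≡z
... | no y≢z = ⊥-elim (1+n≰n (≤-trans (distinct⇒2≤length (neighbour Vy x~y) (neighbour Vz x~z) y≢z) (maxDeg x Vx)))
  where
  neighbour : ∀ {w} → T (V w) → Adjacent x w → w ∈ filterᵇ (λ w → V w ∧ adjᵇ x w) (allPts _)
  neighbour {w} Vw x~w = ∈-filter⁺ (T? ∘ λ w → V w ∧ adjᵇ x w) (∈-allPts w) (Equivalence.from T-∧ (Vw , T-adjᵇ {x = x} {w} x~w))

module _ {k} {U : Pt (suc k) → Bool} (maxDeg : MaxDeg≤1 U) where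

  same-level-neighbours-coincide : ∀ {c x y z} → T (U (c ∷ x)) → T (U (c ∷ y)) → T (U (c ∷ z)) →
    Adjacent x y → Adjacent x z → y ≡ z
  same-level-neighbours-coincide {c} {x} {y} {z} Ucx Ucy Ucz x~y x~z = ∷-injectiveʳ
    (MaxDeg≤1⇒unique-neighbour maxDeg Ucx Ucy Ucz (adjacent-∷ c {x} {y} x~y) (adjacent-∷ c {x} {z} x~z))

  double-level-not-shared : ∀ {a b x y} → a ≢ b → T (U (a ∷ x)) → T (U (b ∷ x)) → Adjacent x y → ¬ T (U (a ∷ y))
  double-level-not-shared {a} {b} {x} {y} a≢b Uax Ubx x~y Uay = a≢b (sym (∷-injectiveˡ
    (MaxDeg≤1⇒unique-neighbour maxDeg Uax Ubx Uay (adjacent-[]≔ (a ∷ x) zero a≢b) (adjacent-∷ a {x} {y} x~y))))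

  shared-level⇒SameFib : ∀ {c x y} → Adjacent x y → T (U (c ∷ x)) → T (U (c ∷ y)) → SameFib U y x
  shared-level⇒SameFib {c} {x} {y} x~y Ucx Ucy d =
    T-injective (transfer (adjacent-sym {x = x} {y} x~y) Ucy Ucx) (transfer x~y Ucx Ucy)
    where
    transfer : ∀ {u v} → Adjacent u v → T (U (c ∷ u)) → T (U (c ∷ v)) → T (U (d ∷ u)) → T (U (d ∷ v))
    transfer u~v Ucu Ucv Udu with d ≟ᶠ c
    ... | yes refl = Ucv
    ... | no d≢c = ⊥-elim (double-level-not-shared (≢-sym d≢c) Ucu Udu u~v Ucv)

  DoubleFibre⇒Terminal : ∀ {x} → DoubleFibre U x → Terminal U x
  DoubleFibre⇒Terminal {x} (a , b , a≢b , Uax , Ubx) i = no-match (+e≡[]≔ x i) (inc₃-≢ _) , no-match (+2e≡[]≔ x i) (inc₃²-≢ _)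
    where
    no-match : ∀ {y c} → y ≡ x [ i ]≔ c → c ≢ lookup x i → ¬ SameFib U y x
    no-match refl c≢xᵢ same = double-level-not-shared a≢b Uax Ubx (adjacent-to-[]≔ x i c≢xᵢ) (subst T (sym (same a)) Uax)

record AvoidingColouring {k} (U : Pt (suc k) → Bool) (H : Aff k) : Set where
  field
    colour : Pt k → Fin 3
    proper : ∀ x y → x ∈A H → y ∈A H → Adjacent x y → colour x ≢ colour y
    avoids : ∀ x → x ∈A H → ¬ T (U (colour x ∷ x))

restrict : ∀ {k} {U : Pt (suc k) → Bool} {H K : Aff k} → (∀ x → x ∈A K → x ∈A H) →
  AvoidingColouring U H → AvoidingColouring U K
restrict K⊆H χ = record
  { colour = colour
  ; proper = λ x y x∈K y∈K → proper x y (K⊆H x x∈K) (K⊆H y y∈K)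
  ; avoids = λ x x∈K → avoids x (K⊆H x x∈K)
  }
  where open AvoidingColouring χ

module _ {k} {U : Pt (suc k) → Bool} (H : Aff k) where

  private
    V : Pt (suc (dimA H)) → Bool
    V z = U (embed (nothing ∷ H) z)

  canonicalFor⇒colouring : CanonicalFor U (nothing ∷ H) → AvoidingColouring U H
  canonicalFor⇒colouring (_ , (I , maxI@(indep , _) , disjoint) , _) =
    record { colour = colour ; proper = proper ; avoids = avoids }
    where
    level : ∀ y → ∃ λ a → T (I (a ∷ y))
    level = maxIndependent⇒level maxI
    colour : Pt k → Fin 3
    colour x = proj₁ (level (proj H x))
    proper : ∀ x y → x ∈A H → y ∈A H → Adjacent x y → colour x ≢ colour y
    proper x y x∈H y∈H x~y same = indep _ _ (proj₂ (level (proj H x))) (proj₂ (level (proj H y)))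
      (subst (λ c → Adjacent (c ∷ proj H x) (colour y ∷ proj H y)) (sym same)
        (adjacent-∷ (colour y) {proj H x} {proj H y} (trans (dist-proj H x∈H y∈H) x~y)))
    avoids : ∀ x → x ∈A H → ¬ T (U (colour x ∷ x))
    avoids x x∈H Ux = disjoint (colour x ∷ proj H x) (proj₂ (level (proj H x)))
      (subst (λ w → T (U (colour x ∷ w))) (sym (embed-proj H x∈H)) Ux)

  canonicalFor⇒DoubleFibre : CanonicalFor U (nothing ∷ H) → ∃ λ x → x ∈A H × DoubleFibre U x
  canonicalFor⇒DoubleFibre (size , _) with pigeonhole (∣Uf∣ V) (allPts (dimA H)) allPts<∣V∣
    where
    allPts<∣V∣ : length (allPts (dimA H)) < sum (map (∣Uf∣ V) (allPts (dimA H)))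
    allPts<∣V∣ = subst₂ _≤_ (trans (+-comm (3 ^ dimA H) 1) (cong suc (sym (length-allPts (dimA H))))) (∣∣≡sum-∣Uf∣ V) size
  ... | y , _ , 2≤∣Uf∣ = embed H y , embed-∈A H y , 2≤∣Uf∣⇒DoubleFibre V y 2≤∣Uf∣

  colouring⇒canonicalFor : OneSaturated U → MaxDeg≤1 U → AvoidingColouring U H →
    ∀ {x} → x ∈A H → DoubleFibre U x → CanonicalFor U (nothing ∷ H)
  colouring⇒canonicalFor sat maxDeg χ {x} x∈H double = size , (graph colourᵣ , graph-maxIndependent properᵣ , disjoint) , maxDegV
    where
    open AvoidingColouring χ
    d = dimA H
    colourᵣ : Pt d → Fin 3
    colourᵣ y = colour (embed H y)
    properᵣ : Proper colourᵣ
    properᵣ y z y~z = proper (embed H y) (embed H z) (embed-∈A H y) (embed-∈A H z) (trans (dist-embed H y z) y~z)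
    disjoint : ∀ z → T (graph colourᵣ z) → ¬ T (V z)
    disjoint (a ∷ y) Ta with a ≟ᶠ colourᵣ y
    ... | yes refl = avoids (embed H y) (embed-∈A H y)
    ... | no _ = ⊥-elim Ta
    double-at : DoubleFibre V (proj H x)
    double-at = subst (DoubleFibre U) (sym (embed-proj H x∈H)) double
    size : 3 ^ d + 1 ≤ ∣ V ∣
    size = subst₂ _≤_ (trans (cong suc (length-allPts d)) (+-comm 1 (3 ^ d))) (sym (∣∣≡sum-∣Uf∣ V))
      (length<sum (∣Uf∣ V) (λ y → level⇒1≤∣Uf∣ V y (proj₂ (OneSaturated⇒level sat (embed H y))))
        (∈-allPts (proj H x)) (DoubleFibre⇒2≤∣Uf∣ V (proj H x) double-at))
    maxDegV : MaxDeg≤1 V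
    maxDegV z Vz = ≤-trans (∣∣-mono-embed (nothing ∷ H) neighbour) (maxDeg (embed (nothing ∷ H) z) Vz)
      where
      neighbour : ∀ w → T (V w ∧ adjᵇ z w) → T (U (embed (nothing ∷ H) w) ∧ adjᵇ (embed (nothing ∷ H) z) (embed (nothing ∷ H) w))
      neighbour w = subst (λ δ → T (V w ∧ does (δ ≟ 1))) (sym (dist-embed (nothing ∷ H) z w))

-- Canonical paths

SameFib? : ∀ {k} (U : Pt (suc k) → Bool) y x → Dec (SameFib U y x)
SameFib? U y x = all? λ a → Uf U y a ≟ᵇ Uf U x a

SameFib-on-line⇒¬Terminal : ∀ {k} {U : Pt (suc k) → Bool} {x i c} → c ≢ lookup x i →
  SameFib U (x [ i ]≔ c) x → ¬ Terminal U x
SameFib-on-line⇒¬Terminal {U = U} {x} {i} c≢xᵢ same terminal with ≢⇒inc₃⊎inc₃² c≢xᵢ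
... | inj₁ refl = proj₁ (terminal i) (subst (λ q → SameFib U q x) (sym (+e≡[]≔ x i)) same)
... | inj₂ refl = proj₂ (terminal i) (subst (λ q → SameFib U q x) (sym (+2e≡[]≔ x i)) same)

¬Terminal⇒Step : ∀ {k} {U : Pt (suc k) → Bool} {x} → ¬ Terminal U x → ∃ (Step U x)
¬Terminal⇒Step {U = U} {x} ¬terminal with any? (λ i → SameFib? U (x +e i) x ⊎-dec SameFib? U (x +2e i) x)
... | yes (i , inj₁ same) = x +2e i , i , inj₁ (same , refl)
... | yes (i , inj₂ same) = x +e i , i , inj₂ (same , refl)
... | no none = ⊥-elim (¬terminal λ i → (λ same → none (i , inj₁ same)) , (λ same → none (i , inj₂ same)))

PathEndsAt-functional : ∀ {k} {U : Pt (suc k) → Bool} {z z' x} → PathEndsAt U z x → PathEndsAt U z' x → z ≡ z'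
PathEndsAt-functional (stop _ x≡z) (stop _ x≡z') = trans (sym x≡z) x≡z'
PathEndsAt-functional (stop terminal _) (go ¬terminal _) = ⊥-elim (¬terminal terminal)
PathEndsAt-functional (go ¬terminal _) (stop terminal _) = ⊥-elim (¬terminal terminal)
PathEndsAt-functional {U = U} (go ¬terminal next) (go _ next') with ¬Terminal⇒Step {U = U} ¬terminal
... | y , step = PathEndsAt-functional (next y step) (next' y step)

module RookSquare
  (W : Fin 3 → Fin 3 → Fin 3 → Set)
  (G : Fin 3 → Fin 3 → Fin 3)
  (G-row : ∀ {m m'} n → m ≢ m' → G m n ≢ G m' n)
  (G-col : ∀ m {n n'} → n ≢ n' → G m n ≢ G m n')
  (saturated : ∀ m n → ∃ λ c → W c m n)
  (avoids : ∀ {c m n} → W c m n → c ≢ G m n)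
  (corner : ∀ {c m m' n n'} → m ≢ m' → n ≢ n' → W c m n → W c m n' → W c m' n → ⊥)
  {δ : Fin 3} (W01 : W δ 0F 1F) (W02 : W δ 0F 2F)
  where

  private
    s : Fin 3 → Fin 3 → Fin 3
    s m n = proj₁ (saturated m n)

    W-s : ∀ m n → W (s m n) m n
    W-s m n = proj₂ (saturated m n)

    W-≡ : ∀ {c d m n} → c ≡ d → W c m n → W d m n
    W-≡ refl w = w

    δ≡G00 : δ ≡ G 0F 0F
    δ≡G00 = avoiding⇒≡ (G-col 0F (λ ())) (avoids W01) (avoids W02) (G-col 0F (λ ())) (G-col 0F (λ ()))

    off-row-0 : ∀ {c m n} → m ≢ 0F → n ≢ 0F → W c m n → c ≢ G 0F 0F
    off-row-0 {n = 0F} _ n≢0 _ _ = n≢0 refl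
    off-row-0 {n = 1F} m≢0 _ Wc c≡G00 = corner (≢-sym m≢0) (λ ()) W01 W02 (W-≡ (trans c≡G00 (sym δ≡G00)) Wc)
    off-row-0 {n = 2F} m≢0 _ Wc c≡G00 = corner (≢-sym m≢0) (λ ()) W02 W01 (W-≡ (trans c≡G00 (sym δ≡G00)) Wc)

    SharedLevel : Set
    SharedLevel = ∃ λ v → W v 1F 1F × (W v 2F 1F ⊎ W v 1F 2F)

    diagonal : G 1F 1F ≡ G 0F 0F → SharedLevel
    diagonal G11≡G00 = by-s11 (s 1F 1F ≟ᶠ G 2F 1F)
      where
      G21≢G00 : G 2F 1F ≢ G 0F 0F
      G21≢G00 e = G-row 1F (λ ()) (trans e (sym G11≡G00))
      G12≢G00 : G 1F 2F ≢ G 0F 0F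
      G12≢G00 e = G-col 1F (λ ()) (trans e (sym G11≡G00))
      G21≢G12 : G 2F 1F ≢ G 1F 2F
      G21≢G12 e = G-row 0F (λ ()) (avoiding⇒≡ (≢-sym G21≢G00) (G-row 0F (λ ()))
        (λ e' → G-col 1F (λ ()) (trans e' e)) (G-row 0F (λ ())) (G-col 2F (λ ())))
      by-s11 : Dec (s 1F 1F ≡ G 2F 1F) → SharedLevel
      by-s11 (yes s11≡G21) = s 1F 1F , W-s 1F 1F , inj₂ (W-≡ s12≡s11 (W-s 1F 2F))
        where
        s12≡s11 = trans (avoiding⇒≡ (≢-sym G12≢G00) (off-row-0 (λ ()) (λ ()) (W-s 1F 2F)) (avoids (W-s 1F 2F))
          G21≢G00 G21≢G12) (sym s11≡G21)
      by-s11 (no s11≢G21) = s 1F 1F , W-s 1F 1F , inj₁ (W-≡ s21≡s11 (W-s 2F 1F))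
        where
        s21≡s11 = avoiding⇒≡ (≢-sym G21≢G00) (off-row-0 (λ ()) (λ ()) (W-s 2F 1F)) (avoids (W-s 2F 1F))
          (off-row-0 (λ ()) (λ ()) (W-s 1F 1F)) s11≢G21

    antidiagonal : G 1F 1F ≢ G 0F 0F → SharedLevel
    antidiagonal G11≢G00 = by-s21-s12 (s 2F 1F ≟ᶠ v) (s 1F 2F ≟ᶠ v)
      where
      v = s 1F 1F
      v≢G00 : v ≢ G 0F 0F
      v≢G00 = off-row-0 (λ ()) (λ ()) (W-s 1F 1F)
      v≢G11 : v ≢ G 1F 1F
      v≢G11 = avoids (W-s 1F 1F)
      G00≡G12 : G 0F 0F ≡ G 1F 2F
      G00≡G12 = avoiding⇒≡ (G-col 1F (λ ())) (G-row 0F (λ ())) (≢-sym G11≢G00) (G-col 1F (λ ())) (G-col 1F (λ ()))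
      G01≡v : G 0F 1F ≡ v
      G01≡v = avoiding⇒≡ (≢-sym G11≢G00) (G-col 0F (λ ())) (G-row 1F (λ ())) v≢G00 v≢G11
      G02≡G11 : G 0F 2F ≡ G 1F 1F
      G02≡G11 = avoiding⇒≡ (≢-sym v≢G00) (G-col 0F (λ ())) (λ e → G-col 0F (λ ()) (trans e (sym G01≡v)))
        G11≢G00 (≢-sym v≢G11)
      G22≡v : G 2F 2F ≡ v
      G22≡v = avoiding⇒≡ (≢-sym G11≢G00) (λ e → G-row 2F (λ ()) (trans e G00≡G12))
        (λ e → G-row 2F (λ ()) (trans e (sym G02≡G11))) v≢G00 v≢G11
      off-v⇒G11 : ∀ {m n} → m ≢ 0F → n ≢ 0F → s m n ≢ v → s m n ≡ G 1F 1F
      off-v⇒G11 m≢0 n≢0 s≢v = avoiding⇒≡ (≢-sym v≢G00) (off-row-0 m≢0 n≢0 (W-s _ _)) s≢v G11≢G00 (≢-sym v≢G11)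
      by-s21-s12 : Dec (s 2F 1F ≡ v) → Dec (s 1F 2F ≡ v) → SharedLevel
      by-s21-s12 (yes s21≡v) _ = v , W-s 1F 1F , inj₁ (W-≡ s21≡v (W-s 2F 1F))
      by-s21-s12 (no _) (yes s12≡v) = v , W-s 1F 1F , inj₂ (W-≡ s12≡v (W-s 1F 2F))
      by-s21-s12 (no s21≢v) (no s12≢v) = ⊥-elim (corner {m = 2F} {1F} {2F} {1F} (λ ()) (λ ())
        (W-≡ (off-v⇒G11 (λ ()) (λ ()) (λ e → avoids (W-s 2F 2F) (trans e (sym G22≡v)))) (W-s 2F 2F))
        (W-≡ (off-v⇒G11 (λ ()) (λ ()) s21≢v) (W-s 2F 1F))
        (W-≡ (off-v⇒G11 (λ ()) (λ ()) s12≢v) (W-s 1F 2F)))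

  -- The level shared in row 0 is its missing colour G 0 0, which no cell outside row and column 0
  -- carries; G 0 0 reappears in the lower right 2 × 2 block on its diagonal or on its antidiagonal.
  shared-level : ∃ λ v → W v 1F 1F × (W v 2F 1F ⊎ W v 1F 2F)
  shared-level with G 1F 1F ≟ᶠ G 0F 0F
  ... | yes G11≡G00 = diagonal G11≡G00
  ... | no G11≢G00 = antidiagonal G11≢G00

pick : ∀ {A : Set} → A → A → A → Fin 3 → A
pick u _ _ 0F = u
pick _ v _ 1F = v
pick _ _ w 2F = w

pick-injective : ∀ {A : Set} {u v w : A} → u ≢ v → u ≢ w → v ≢ w → ∀ {m m'} → m ≢ m' → pick u v w m ≢ pick u v w m'
pick-injective u≢v u≢w v≢w {0F} {0F} m≢m' = ⊥-elim (m≢m' refl)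
pick-injective u≢v u≢w v≢w {0F} {1F} _ = u≢v
pick-injective u≢v u≢w v≢w {0F} {2F} _ = u≢w
pick-injective u≢v u≢w v≢w {1F} {0F} _ = ≢-sym u≢v
pick-injective u≢v u≢w v≢w {1F} {1F} m≢m' = ⊥-elim (m≢m' refl)
pick-injective u≢v u≢w v≢w {1F} {2F} _ = v≢w
pick-injective u≢v u≢w v≢w {2F} {0F} _ = ≢-sym u≢w
pick-injective u≢v u≢w v≢w {2F} {1F} _ = ≢-sym v≢w
pick-injective u≢v u≢w v≢w {2F} {2F} m≢m' = ⊥-elim (m≢m' refl)

module Grid {k} (x : Pt k) {i j : Fin k} (i≢j : i ≢ j) (α β : Fin 3 → Fin 3) where

  P : Fin 3 → Fin 3 → Pt k
  P m n = (x [ i ]≔ α m) [ j ]≔ β n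

  P-lookupᵢ : ∀ m n → lookup (P m n) i ≡ α m
  P-lookupᵢ m n = trans (lookup∘update′ i≢j (x [ i ]≔ α m) (β n)) (lookup∘update i x (α m))

  row-adjacent : ∀ {m m'} n → α m ≢ α m' → Adjacent (P m n) (P m' n)
  row-adjacent n αm≢αm' = subst₂ Adjacent (sym ([]≔-commutes x i j i≢j)) (sym ([]≔-commutes x i j i≢j))
    (adjacent-[]≔ (x [ j ]≔ β n) i αm≢αm')

  col-adjacent : ∀ m {n n'} → β n ≢ β n' → Adjacent (P m n) (P m n')
  col-adjacent m βn≢βn' = adjacent-[]≔ (x [ i ]≔ α m) j βn≢βn'

module Paths {k} {U : Pt (suc k) → Bool} (saturated : ∀ x → ∃ λ a → T (U (a ∷ x))) (maxDeg : MaxDeg≤1 U)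
  {H : Aff k} (χ : AvoidingColouring U H) {xe : Pt k} (xe∈H : xe ∈A H) (double : DoubleFibre U xe) where

  open AvoidingColouring χ

  -- The partner x [ dir ]≔ value has the same fibre as x, so every canonical path at x
  -- steps to x [ dir ]≔ lookup xe dir, one unit closer to xe.
  record Descent (x : Pt k) : Set where
    field
      dir : Fin k
      value level : Fin 3
      differs : lookup x dir ≢ lookup xe dir
      value≢x : value ≢ lookup x dir
      value≢xe : value ≢ lookup xe dir
      U-level : T (U (level ∷ x))
      U-partner : T (U (level ∷ (x [ dir ]≔ value)))

  neighbour-level : ∀ {y} → Adjacent xe y → T (U (colour xe ∷ y))
  neighbour-level {y} xe~y = level-of double (saturated y)
    where
    level-of : DoubleFibre U xe → (∃ λ c → T (U (c ∷ y))) → T (U (colour xe ∷ y))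
    level-of (a , b , a≢b , Ua , Ub) (c , Ucy) =
      subst (λ c → T (U (c ∷ y))) (avoiding⇒≡ a≢b c≢a c≢b (colour≢ Ua) (colour≢ Ub)) Ucy
      where
      c≢a : c ≢ a
      c≢a refl = double-level-not-shared maxDeg a≢b Ua Ub xe~y Ucy
      c≢b : c ≢ b
      c≢b refl = double-level-not-shared maxDeg (≢-sym a≢b) Ub Ua xe~y Ucy
      colour≢ : ∀ {a} → T (U (a ∷ xe)) → colour xe ≢ a
      colour≢ Ua refl = avoids xe xe∈H Ua

  descent-adjacent : ∀ {x i} → lookup x i ≢ lookup xe i → x [ i ]≔ lookup xe i ≡ xe → Descent x
  descent-adjacent {x} {i} xᵢ≢xeᵢ x→xe = record
    { dir = i ; value = t ; level = colour xe ; differs = xᵢ≢xeᵢ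
    ; value≢x = third-≢ʳ _ _ ; value≢xe = third-≢ˡ _ _
    ; U-level = neighbour-level (subst (Adjacent xe) (trans (sym (on-xe-line _)) ([]≔-lookup x i)) (adjacent-to-[]≔ xe i xᵢ≢xeᵢ))
    ; U-partner = neighbour-level (subst (Adjacent xe) (sym (on-xe-line t)) (adjacent-to-[]≔ xe i (third-≢ˡ _ _)))
    }
    where
    t = third (lookup xe i) (lookup x i)
    on-xe-line : ∀ c → x [ i ]≔ c ≡ xe [ i ]≔ c
    on-xe-line c = trans (sym ([]≔-idempotent x i)) (cong (_[ i ]≔ c) x→xe)

  grid-shared-level : ∀ {x i j} → x ∈A H → lookup H i ≡ nothing → lookup H j ≡ nothing → (i≢j : i ≢ j) →
    ∀ {α β} → (∀ {m m'} → m ≢ m' → α m ≢ α m') → (∀ {n n'} → n ≢ n' → β n ≢ β n') →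
    let open Grid x i≢j α β in
    ∀ {δ} → T (U (δ ∷ P 0F 1F)) → T (U (δ ∷ P 0F 2F)) →
    ∃ λ v → T (U (v ∷ P 1F 1F)) × (T (U (v ∷ P 2F 1F)) ⊎ T (U (v ∷ P 1F 2F)))
  grid-shared-level {x} {i} {j} x∈H i-free j-free i≢j {α} {β} α-injective β-injective =
    RookSquare.shared-level W G G-row G-col (λ m n → saturated (P m n)) (λ {_} {m} {n} → level≢colour m n) corner
    where
    open Grid x i≢j α β
    rows : ∀ {m m'} n → m ≢ m' → Adjacent (P m n) (P m' n)
    rows n = row-adjacent n ∘ α-injective
    cols : ∀ m {n n'} → n ≢ n' → Adjacent (P m n) (P m n')
    cols m = col-adjacent m ∘ β-injective
    P∈H : ∀ m n → P m n ∈A H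
    P∈H m n = ∈A-[]≔ H (x [ i ]≔ α m) j (β n) (∈A-[]≔ H x i (α m) x∈H i-free) j-free
    W : Fin 3 → Fin 3 → Fin 3 → Set
    W v m n = T (U (v ∷ P m n))
    G : Fin 3 → Fin 3 → Fin 3
    G m n = colour (P m n)
    G-row : ∀ {m m'} n → m ≢ m' → G m n ≢ G m' n
    G-row n m≢m' = proper _ _ (P∈H _ n) (P∈H _ n) (rows n m≢m')
    G-col : ∀ m {n n'} → n ≢ n' → G m n ≢ G m n'
    G-col m n≢n' = proper _ _ (P∈H m _) (P∈H m _) (cols m n≢n')
    level≢colour : ∀ {v} m n → W v m n → v ≢ G m n
    level≢colour m n Uv refl = avoids (P m n) (P∈H m n) Uv
    corner : ∀ {v m m' n n'} → m ≢ m' → n ≢ n' → W v m n → W v m n' → W v m' n → ⊥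
    corner {m = m} {m'} {n} {n'} m≢m' n≢n' Wmn Wmn' Wm'n = α-injective m≢m' (begin
      α m               ≡⟨ sym (P-lookupᵢ m n') ⟩
      lookup (P m n') i ≡⟨ cong (λ y → lookup y i) (same-level-neighbours-coincide maxDeg Wmn Wmn' Wm'n (cols m n≢n') (rows n m≢m')) ⟩
      lookup (P m' n) i ≡⟨ P-lookupᵢ m' n ⟩
      α m'              ∎)
      where open ≡-Reasoning

  descent-step : ∀ {x i} → x ∈A H → lookup x i ≢ lookup xe i → Descent (x [ i ]≔ lookup xe i) → Descent x
  descent-step {x} {i} x∈H xᵢ≢xeᵢ D =
    from-square (grid-shared-level x∈H i-free j-free i≢j α-injective β-injective (U-≡ (sym P01≡p) Uδp) Uδp')
    where
    open Descent D renaming (dir to j; value to a'; level to δ; differs to pⱼ≢xeⱼ; value≢x to a'≢pⱼ;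
                             value≢xe to a'≢xeⱼ; U-level to Uδp; U-partner to Uδp')
    p = x [ i ]≔ lookup xe i
    i-free : lookup H i ≡ nothing
    i-free = differ⇒free H x xe i x∈H xe∈H xᵢ≢xeᵢ
    j-free : lookup H j ≡ nothing
    j-free = differ⇒free H p xe j (∈A-[]≔ H x i _ x∈H i-free) xe∈H pⱼ≢xeⱼ
    i≢j : i ≢ j
    i≢j refl = pⱼ≢xeⱼ (lookup∘update i x _)
    pⱼ≡xⱼ : lookup p j ≡ lookup x j
    pⱼ≡xⱼ = lookup∘update′ (≢-sym i≢j) x _
    t = third (lookup xe i) (lookup x i)
    -- Rows vary coordinate i through (xe, x, t), columns coordinate j through (xe, x, a'),
    -- so the shared level δ lies on cells (0,1) = p and (0,2).
    α β : Fin 3 → Fin 3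
    α = pick (lookup xe i) (lookup x i) t
    β = pick (lookup xe j) (lookup x j) a'
    α-injective : ∀ {m m'} → m ≢ m' → α m ≢ α m'
    α-injective = pick-injective (≢-sym xᵢ≢xeᵢ) (≢-sym (third-≢ˡ _ _)) (≢-sym (third-≢ʳ _ _))
    β-injective : ∀ {n n'} → n ≢ n' → β n ≢ β n'
    β-injective = pick-injective (λ e → pⱼ≢xeⱼ (trans pⱼ≡xⱼ (sym e))) (≢-sym a'≢xeⱼ) (λ e → a'≢pⱼ (trans (sym e) (sym pⱼ≡xⱼ)))
    open Grid x i≢j α β using (P)
    U-≡ : ∀ {v y z} → y ≡ z → T (U (v ∷ y)) → T (U (v ∷ z))
    U-≡ refl Uvy = Uvy
    P01≡p : P 0F 1F ≡ p
    P01≡p = updateAt-id-local j p (sym pⱼ≡xⱼ)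
    P11≡x : P 1F 1F ≡ x
    P11≡x = trans (cong (_[ j ]≔ lookup x j) ([]≔-lookup x i)) ([]≔-lookup x j)
    P21≡ : P 2F 1F ≡ x [ i ]≔ t
    P21≡ = updateAt-id-local j (x [ i ]≔ t) (sym (lookup∘update′ (≢-sym i≢j) x t))
    P12≡ : P 1F 2F ≡ x [ j ]≔ a'
    P12≡ = cong (_[ j ]≔ a') ([]≔-lookup x i)
    from-square : (∃ λ v → T (U (v ∷ P 1F 1F)) × (T (U (v ∷ P 2F 1F)) ⊎ T (U (v ∷ P 1F 2F)))) → Descent x
    from-square (v , W11 , inj₁ W21) = record
      { dir = i ; value = t ; level = v ; differs = xᵢ≢xeᵢ
      ; value≢x = third-≢ʳ _ _ ; value≢xe = third-≢ˡ _ _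
      ; U-level = U-≡ P11≡x W11 ; U-partner = U-≡ P21≡ W21 }
    from-square (v , W11 , inj₂ W12) = record
      { dir = j ; value = a' ; level = v ; differs = λ e → pⱼ≢xeⱼ (trans pⱼ≡xⱼ e)
      ; value≢x = λ e → a'≢pⱼ (trans e (sym pⱼ≡xⱼ)) ; value≢xe = a'≢xeⱼ
      ; U-level = U-≡ P11≡x W11 ; U-partner = U-≡ P12≡ W12 }

  descent : ∀ n x → x ∈A H → dist x xe ≡ suc n → Descent x
  descent n x x∈H d with dist-suc⇒step-toward x xe d
  descent zero x x∈H d | i , xᵢ≢xeᵢ , d' = descent-adjacent xᵢ≢xeᵢ (dist≡0⇒≡ d')
  descent (suc n) x x∈H d | i , xᵢ≢xeᵢ , d' = descent-step x∈H xᵢ≢xeᵢ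
    (descent n _ (∈A-[]≔ H x i _ x∈H (differ⇒free H x xe i x∈H xe∈H xᵢ≢xeᵢ)) d')

  endsAt : ∀ n x → x ∈A H → dist x xe ≡ n → PathEndsAt U xe x
  endsAt zero x _ d = stop (subst (Terminal U) (sym x≡xe) (DoubleFibre⇒Terminal maxDeg double)) x≡xe
    where
    x≡xe = dist≡0⇒≡ d
  endsAt (suc n) x x∈H d = go (SameFib-on-line⇒¬Terminal {U = U} {x} {dir} value≢x same) λ y step →
    subst (PathEndsAt U xe) (sym (step-target step)) (endsAt n z z∈H (suc-injective (trans (sym (dist-step-toward x xe dir differs)) d)))
    where
    open Descent (descent n x x∈H d)
    z = x [ dir ]≔ lookup xe dir
    z∈H : z ∈A H
    z∈H = ∈A-[]≔ H x dir _ x∈H (differ⇒free H x xe dir x∈H xe∈H differs)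
    x~partner : Adjacent x (x [ dir ]≔ value)
    x~partner = adjacent-to-[]≔ x dir value≢x
    same : SameFib U (x [ dir ]≔ value) x
    same = shared-level⇒SameFib maxDeg x~partner U-level U-partner
    third-on-line≡z : ∀ {j c c'} → c ≢ lookup x j → c' ≢ lookup x j → c' ≢ c → SameFib U (x [ j ]≔ c) x → x [ j ]≔ c' ≡ z
    third-on-line≡z {j} {c} {c'} c≢xⱼ c'≢xⱼ c'≢c same'
      with []≔-injective x c≢xⱼ (same-level-neighbours-coincide maxDeg U-level (subst T (sym (same' level)) U-level) U-partner
                                   (adjacent-to-[]≔ x j c≢xⱼ) x~partner)
    ... | refl , refl = cong (x [ dir ]≔_) (avoiding⇒≡ (≢-sym value≢x) c'≢xⱼ c'≢c (≢-sym differs) (≢-sym value≢xe))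
    step-target : ∀ {y} → Step U x y → y ≡ z
    step-target (j , inj₁ (same' , refl)) = trans (+2e≡[]≔ x j)
      (third-on-line≡z (inc₃-≢ _) (inc₃²-≢ _) (inc₃²-≢-inc₃ _) (subst (λ q → SameFib U q x) (+e≡[]≔ x j) same'))
    step-target (j , inj₂ (same' , refl)) = trans (+e≡[]≔ x j)
      (third-on-line≡z (inc₃²-≢ _) (inc₃-≢ _) (≢-sym (inc₃²-≢-inc₃ _)) (subst (λ q → SameFib U q x) (+2e≡[]≔ x j) same'))

  pathEndsAt : ∀ x → x ∈A H → PathEndsAt U xe x
  pathEndsAt x x∈H = endsAt (dist x xe) x x∈H refl

module _ {k} {U : Pt (suc k) → Bool} (sat : OneSaturated U) (maxDeg : MaxDeg≤1 U) where

  canonicalFor⇒PathEndsAt : (H : Aff k) → CanonicalFor U (nothing ∷ H) →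
    ∀ {xe} → xe ∈A H → DoubleFibre U xe → ∀ x → x ∈A H → PathEndsAt U xe x
  canonicalFor⇒PathEndsAt H can xe∈H double =
    Paths.pathEndsAt (OneSaturated⇒level sat) maxDeg (canonicalFor⇒colouring {U = U} H can) xe∈H double

  module _ (H' H'' : Aff k) (can' : CanonicalFor U (nothing ∷ H')) (can'' : CanonicalFor U (nothing ∷ H''))
           (y : Pt k) (y∈H' : y ∈A H') (y∈H'' : y ∈A H'') where

    doubleFibres-coincide : ∀ xe' xe'' → xe' ∈A H' → DoubleFibre U xe' → xe'' ∈A H'' → DoubleFibre U xe'' → xe' ≡ xe''
    doubleFibres-coincide xe' xe'' xe'∈H' double' xe''∈H'' double'' = PathEndsAt-functional {U = U}
      (canonicalFor⇒PathEndsAt H' can' xe'∈H' double' y y∈H')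
      (canonicalFor⇒PathEndsAt H'' can'' xe''∈H'' double'' y y∈H'')

    canonicalFor-meetA : CanonicalFor U (nothing ∷ meetA H' H'')
    canonicalFor-meetA with canonicalFor⇒DoubleFibre {U = U} H' can' | canonicalFor⇒DoubleFibre {U = U} H'' can''
    ... | xe , xe∈H' , double | xe'' , xe''∈H'' , double'' =
      colouring⇒canonicalFor (meetA H' H'') sat maxDeg
        (restrict (λ x → ∈A-meetA⇒∈A {H = H'} {H''} {x}) (canonicalFor⇒colouring {U = U} H' can'))
        (∈A-meetA {H = H'} {H''} {xe} xe∈H' xe∈H'') double
      where
      xe∈H'' : xe ∈A H''
      xe∈H'' = subst (_∈A H'') (sym (doubleFibres-coincide xe xe'' xe∈H' double xe''∈H'' double'')) xe''∈H''

lemma3p18 : (k : ℕ) (U : Pt (suc k) → Bool) → OneSaturated U → MaxDeg≤1 U →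
    (H'red H''red : Aff k) →
    (CanonicalFor U (nothing ∷ H'red) →
       ∀ xe → xe ∈A H'red → ∣Uf∣ U xe ≡ 2 →
       ∀ x → x ∈A H'red → PathEndsAt U xe x)
    ×
    (CanonicalFor U (nothing ∷ H'red) → CanonicalFor U (nothing ∷ H''red) →
       (∃ λ y → y ∈A (nothing ∷ H'red) × y ∈A (nothing ∷ H''red)) →
       (∀ xe' xe'' → xe' ∈A H'red → ∣Uf∣ U xe' ≡ 2 → xe'' ∈A H''red → ∣Uf∣ U xe'' ≡ 2 →
          xe' ≡ xe'')
       × CanonicalFor U (nothing ∷ meetA H'red H''red))
lemma3p18 k U sat maxDeg H' H'' =
  (λ can xe xe∈H' ∣Uf∣≡2 → canonicalFor⇒PathEndsAt sat maxDeg H' can xe∈H' (double ∣Uf∣≡2)) ,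
  λ { can' can'' ((_ ∷ y) , y∈H' , y∈H'') →
        (λ xe' xe'' xe'∈H' ∣Uf∣'≡2 xe''∈H'' ∣Uf∣''≡2 →
           doubleFibres-coincide sat maxDeg H' H'' can' can'' y y∈H' y∈H''
             xe' xe'' xe'∈H' (double ∣Uf∣'≡2) xe''∈H'' (double ∣Uf∣''≡2)) ,
        canonicalFor-meetA sat maxDeg H' H'' can' can'' y y∈H' y∈H'' }
  where
  double : ∀ {xe} → ∣Uf∣ U xe ≡ 2 → DoubleFibre U xe
  double {xe} ∣Uf∣≡2 = 2≤∣Uf∣⇒DoubleFibre U xe (≤-reflexive (sym ∣Uf∣≡2))
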